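{- Let $j\ge 2$ be an integer, and set $k=2j-1$ and $n=2g(j)$. Then every ordered $(n,k)$-sequence $e_1\ge e_2\ge\dots\ge e_k$ with $e_1\ge g(j)^2$ is a G-sequence.
   Context: A Gallai coloring (G-coloring) of $K_n$ is an edge coloring of $K_n$ with no triangle whose three edges receive three different colors. An $(n,k)$-sequence is a sequence $e_1,\dots,e_k$ of nonnegative integers with $\sum_{i=1}^k e_i=\binom{n}{2}$; it is a G-sequence if there is a G-coloring of $K_n$ with colors $1,\dots,k$ in which exactly $e_i$ edges have color $i$ for each $i$. For every integer $k\ge 2$, $g(k)$ is the unique integer such that every $(n,k)$-sequence is a G-sequence if and only if $n\ge g(k)$. -}

module Defs where

open import Data.Nat using (ℕ; zero; suc; _+_; _*_; _∸_; _≤_; _<_; _<?_)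
open import Data.Nat.Combinatorics using (_C_)
open import Data.Fin using (Fin; toℕ) renaming (_≟_ to _≟ᶠ_; _≤_ to _≤ᶠ_)
open import Data.List using (List; map; allFin)
open import Data.Nat.ListAction using (sum)
open import Data.Bool using (Bool; true; false; if_then_else_; _∧_)
open import Data.Product using (Σ; _×_; _,_)
open import Data.Sum using (_⊎_)
open import Relation.Binary.PropositionalEquality using (_≡_; _≢_)
open import Relation.Nullary using (¬_)
open import Relation.Nullary.Decidable using (⌊_⌋)

-- An edge colouring of K_n with colours Fin k: a symmetric function on
-- ordered pairs of vertices (values on the diagonal are irrelevant).
Coloring : ℕ → ℕ → Set
Coloring n k = Fin n → Fin n → Fin k

Symmetric : ∀ {n k} → Coloring n k → Set
Symmetric {n} c = (x y : Fin n) → c x y ≡ c y x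

Gallai : ∀ {n k} → Coloring n k → Set
Gallai {n} c = (x y z : Fin n) → x ≢ y → y ≢ z → x ≢ z →
  ¬ (c x y ≢ c y z × c y z ≢ c x z × c x y ≢ c x z)

colorCount : ∀ {n k} → Coloring n k → Fin k → ℕ
colorCount {n} c i =
  sum (map (λ x → sum (map (λ y →
         if ⌊ toℕ x <? toℕ y ⌋ ∧ ⌊ c x y ≟ᶠ i ⌋ then 1 else 0)
       (allFin n))) (allFin n))

IsSeq : (n k : ℕ) → (Fin k → ℕ) → Set
IsSeq n k e = sum (map e (allFin k)) ≡ n C 2

IsGSeq : (n k : ℕ) → (Fin k → ℕ) → Set
IsGSeq n k e = Σ (Coloring n k) λ c →
  Symmetric c × Gallai c × ((i : Fin k) → colorCount c i ≡ e i)

AllGSeq : (n k : ℕ) → Set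
AllGSeq n k = (e : Fin k → ℕ) → IsSeq n k e → IsGSeq n k e

-- m = g(k): the least threshold (over n ≥ 1) such that every (n,k)-sequence
-- is a G-sequence for all n ≥ m.
IsG : (k m : ℕ) → Set
IsG k m = 1 ≤ m × ((n : ℕ) → m ≤ n → AllGSeq n k) × (m ≡ 1 ⊎ ¬ AllGSeq (m ∸ 1) k)

Nonincreasing : ∀ {k} → (Fin k → ℕ) → Set
Nonincreasing {k} e = (i i' : Fin k) → i ≤ᶠ i' → e i' ≤ e i

-- Split K_{2m} into two copies of K_m and give the m² edges between them the first color,
-- which is possible as e₁ ≥ m². Pair the remaining colors as (e₂, e₃), (e₄, e₅), …: block A
-- gets the smaller color of each pair, block B what is left of the first color and the larger
-- color of each pair. The smaller colors weigh W ≤ C(m,2), so A still needs d = C(m,2) − W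
-- edges, which B cedes from its first or its second color (monotonicity makes one of them large
-- enough). Both blocks then carry (m,j)-sequences, realised by Gallai colorings since m = g(j),
-- and the glued coloring is Gallai because a triangle meeting both blocks has two edges of the
-- first color.

module Submission where

open import Defs
open import Data.Nat using (ℕ; zero; suc; _+_; _*_; _∸_; _≤_; _<?_; _≤?_; z≤n; s≤s)
open import Data.Nat.Properties
open import Algebra.Properties.CommutativeMonoid.Sum +-0-commutativeMonoid
  using (sum-syntax; sum-cong-≗; sum-init-last; ∑-distrib-+)
import Data.Nat.ListAction as List
open import Data.Fin using (Fin; zero; suc; toℕ; fromℕ; _↑ˡ_; _↑ʳ_; splitAt; join; combine; inject₁)
  renaming (_≟_ to _≟ᶠ_; _≤_ to _≤ᶠ_; _<_ to _<ᶠ_)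
open import Data.Fin.Properties
  using (toℕ-↑ˡ; toℕ-↑ʳ; toℕ<n; splitAt-↑ˡ; splitAt-↑ʳ; join-splitAt; toℕ-combine;
         combine-monoˡ-<; combine-injectiveˡ; combine-injectiveʳ; combine-surjective; toℕ-inject₁)
  renaming (suc-injective to fsuc-injective)
open import Data.Fin.Patterns using (0F; 1F)
open import Data.List using (allFin; tabulate; map)
open import Data.List.Properties using (map-tabulate; map-cong)
open import Data.Vec.Functional using (updateAt)
open import Data.Vec.Functional.Properties using (updateAt-updates; updateAt-minimal)
open import Data.Nat.Combinatorics using (_C_; nC1≡n; nCk+nC[k+1]≡[n+1]C[k+1])
open import Data.Nat.Tactic.RingSolver using (solve-∀)
open import Data.Bool using (Bool; true; false; if_then_else_; _∧_)
open import Data.Bool.Properties using (∧-zeroʳ)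
open import Data.Product using (∃; _×_; _,_; proj₁; proj₂)
open import Data.Sum using (_⊎_; inj₁; inj₂)
open import Function using (_∘_; id)
open import Function.Definitions using (Injective)
open import Relation.Binary.PropositionalEquality
open import Relation.Nullary using (¬_; Dec; yes; no; contradiction)
open import Relation.Nullary.Decidable using (⌊_⌋; isYes≗does; dec-true; dec-false)

private variable
  a b j k n : ℕ
  A : Set

⌊⌋-true : (a? : Dec A) → A → ⌊ a? ⌋ ≡ true
⌊⌋-true a? a = trans (isYes≗does a?) (dec-true a? a)

⌊⌋-false : (a? : Dec A) → ¬ A → ⌊ a? ⌋ ≡ false
⌊⌋-false a? ¬a = trans (isYes≗does a?) (dec-false a? ¬a)

⌊a+m<?a+n⌋≡⌊m<?n⌋ : ∀ a m n → ⌊ a + m <? a + n ⌋ ≡ ⌊ m <? n ⌋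
⌊a+m<?a+n⌋≡⌊m<?n⌋ a m n with m <? n
... | yes m<n = ⌊⌋-true (a + m <? a + n) (+-monoʳ-< a m<n)
... | no m≮n = ⌊⌋-false (a + m <? a + n) (m≮n ∘ +-cancelˡ-< a m n)

sum-map-allFin : (f : Fin n → ℕ) → List.sum (map f (allFin n)) ≡ ∑[ i < n ] f i
sum-map-allFin f = trans (cong List.sum (map-tabulate id f)) (sum-tabulate f)
  where
  sum-tabulate : ∀ {n} (f : Fin n → ℕ) → List.sum (tabulate f) ≡ ∑[ i < n ] f i
  sum-tabulate {zero} f = refl
  sum-tabulate {suc n} f = cong (f zero +_) (sum-tabulate (f ∘ suc))

∑-const : ∀ n c → ∑[ i < n ] c ≡ n * c
∑-const zero c = refl
∑-const (suc n) c = cong (c +_) (∑-const n c)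

∑-mono-≤ : {f g : Fin n → ℕ} → (∀ i → f i ≤ g i) → ∑[ i < n ] f i ≤ ∑[ i < n ] g i
∑-mono-≤ {zero} f≤g = z≤n
∑-mono-≤ {suc n} f≤g = +-mono-≤ (f≤g zero) (∑-mono-≤ (f≤g ∘ suc))

∑∑-cong : {f g : Fin n → Fin k → ℕ} → (∀ x y → f x y ≡ g x y) →
  ∑[ x < n ] ∑[ y < k ] f x y ≡ ∑[ x < n ] ∑[ y < k ] g x y
∑∑-cong f≗g = sum-cong-≗ (λ x → sum-cong-≗ (f≗g x))

∑∑-indicator : ∀ n k (β : Bool) → ∑[ x < n ] ∑[ y < k ] (if β then 1 else 0) ≡ (if β then n * k else 0)
∑∑-indicator n k β = trans (sum-cong-≗ {n} (λ _ → ∑-const k _)) (trans (∑-const n _) (n*[k*β]≡ β))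
  where
  n*[k*β]≡ : ∀ β → n * (k * (if β then 1 else 0)) ≡ (if β then n * k else 0)
  n*[k*β]≡ true = cong (n *_) (*-identityʳ k)
  n*[k*β]≡ false = trans (cong (n *_) (*-zeroʳ k)) (*-zeroʳ n)

∑-↑ : ∀ a (f : Fin (a + b) → ℕ) → ∑[ u < a + b ] f u ≡ ∑[ x < a ] f (x ↑ˡ b) + ∑[ y < b ] f (a ↑ʳ y)
∑-↑ zero f = refl
∑-↑ (suc a) f = trans (cong (f zero +_) (∑-↑ a (f ∘ suc))) (sym (+-assoc (f zero) _ _))

∑-combine : ∀ m (f : Fin (m * n) → ℕ) → ∑[ i < m * n ] f i ≡ ∑[ s < m ] ∑[ t < n ] f (combine s t)
∑-combine zero f = refl
∑-combine {n} (suc m) f = trans (∑-↑ n f) (cong (∑[ t < n ] f (t ↑ˡ (m * n)) +_) (∑-combine m (f ∘ (n ↑ʳ_))))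

∑-updateAt-∸ : (f : Fin n → ℕ) (t : Fin n) {d : ℕ} → d ≤ f t → ∑[ i < n ] updateAt f t (_∸ d) i + d ≡ ∑[ i < n ] f i
∑-updateAt-∸ f zero {d} d≤f₀ = begin
  f zero ∸ d + S + d   ≡⟨ +-assoc (f zero ∸ d) S d ⟩
  f zero ∸ d + (S + d) ≡⟨ cong (f zero ∸ d +_) (+-comm S d) ⟩
  f zero ∸ d + (d + S) ≡⟨ sym (+-assoc (f zero ∸ d) d S) ⟩
  f zero ∸ d + d + S   ≡⟨ cong (_+ S) (m∸n+n≡m d≤f₀) ⟩
  f zero + S           ∎
  where
  open ≡-Reasoning
  S = ∑[ i < _ ] f (suc i)
∑-updateAt-∸ f (suc t) d≤fₜ =
  trans (+-assoc (f zero) _ _) (cong (f zero +_) (∑-updateAt-∸ (f ∘ suc) t d≤fₜ))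

[1+n]C2≡n+nC2 : ∀ n → suc n C 2 ≡ n + n C 2
[1+n]C2≡n+nC2 n = trans (sym (nCk+nC[k+1]≡[n+1]C[k+1] n 1)) (cong (_+ n C 2) (nC1≡n n))

[m+n]C2≡mC2+m*n+nC2 : ∀ m n → (m + n) C 2 ≡ m C 2 + m * n + n C 2
[m+n]C2≡mC2+m*n+nC2 zero n = refl
[m+n]C2≡mC2+m*n+nC2 (suc m) n = begin
  suc (m + n) C 2                            ≡⟨ [1+n]C2≡n+nC2 (m + n) ⟩
  m + n + (m + n) C 2                        ≡⟨ cong (m + n +_) ([m+n]C2≡mC2+m*n+nC2 m n) ⟩
  m + n + (m C 2 + m * n + n C 2)            ≡⟨ rearrange m n (m C 2) (m * n) (n C 2) ⟩
  m + m C 2 + (n + m * n) + n C 2            ≡⟨ cong (λ x → x + (n + m * n) + n C 2) ([1+n]C2≡n+nC2 m) ⟨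
  suc m C 2 + suc m * n + n C 2              ∎
  where
  open ≡-Reasoning
  rearrange : ∀ m n a x c → m + n + (a + x + c) ≡ m + a + (n + x) + c
  rearrange = solve-∀

edgeOfColor : Coloring n k → Fin k → Fin n → Fin n → ℕ
edgeOfColor c i x y = if ⌊ toℕ x <? toℕ y ⌋ ∧ ⌊ c x y ≟ᶠ i ⌋ then 1 else 0

colorCount-∑ : (c : Coloring n k) (i : Fin k) →
  colorCount c i ≡ ∑[ x < n ] ∑[ y < n ] edgeOfColor c i x y
colorCount-∑ {n} c i =
  trans (cong List.sum (map-cong (λ x → sum-map-allFin (edgeOfColor c i x)) (allFin n)))
        (sum-map-allFin {n} _)

colorCount-cong : (c : Coloring n j) (c′ : Coloring n k) {i : Fin j} {i′ : Fin k} →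
  (∀ x y → ⌊ c x y ≟ᶠ i ⌋ ≡ ⌊ c′ x y ≟ᶠ i′ ⌋) → colorCount c i ≡ colorCount c′ i′
colorCount-cong c c′ {i} {i′} same = begin
  colorCount c i                              ≡⟨ colorCount-∑ c i ⟩
  ∑[ x < _ ] ∑[ y < _ ] edgeOfColor c i x y   ≡⟨ ∑∑-cong (λ x y → cong (λ β → if ⌊ toℕ x <? toℕ y ⌋ ∧ β then 1 else 0) (same x y)) ⟩
  ∑[ x < _ ] ∑[ y < _ ] edgeOfColor c′ i′ x y ≡⟨ colorCount-∑ c′ i′ ⟨
  colorCount c′ i′                            ∎
  where open ≡-Reasoning

colorCount-unused : (c : Coloring n k) {i : Fin k} → (∀ x y → c x y ≢ i) → colorCount c i ≡ 0
colorCount-unused {n} c {i} unused =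
  trans (colorCount-∑ c i) (trans (∑∑-cong edge-absent) (∑∑-indicator n n false))
  where
  edge-absent : ∀ x y → edgeOfColor c i x y ≡ 0
  edge-absent x y rewrite ⌊⌋-false (c x y ≟ᶠ i) (unused x y) | ∧-zeroʳ ⌊ toℕ x <? toℕ y ⌋ = refl

recolor : (Fin j → Fin k) → Coloring n j → Coloring n k
recolor f c x y = f (c x y)

recolor-symmetric : (f : Fin j → Fin k) {c : Coloring n j} → Symmetric c → Symmetric (recolor f c)
recolor-symmetric f sym-c x y = cong f (sym-c x y)

recolor-gallai : (f : Fin j → Fin k) {c : Coloring n j} → Gallai c → Gallai (recolor f c)
recolor-gallai f gallai x y z x≢y y≢z x≢z (xy≢yz , yz≢xz , xy≢xz) =
  gallai x y z x≢y y≢z x≢z (xy≢yz ∘ cong f , yz≢xz ∘ cong f , xy≢xz ∘ cong f)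

record Pushforward (f : Fin j → Fin k) (g : Fin j → ℕ) (κ : Fin k → ℕ) : Set where
  field
    on-image  : ∀ t → κ (f t) ≡ g t
    off-image : ∀ i → (∀ t → f t ≢ i) → κ i ≡ 0

recolor-pushforward : {f : Fin j → Fin k} → Injective _≡_ _≡_ f → (c : Coloring n j) {g : Fin j → ℕ} →
  (∀ t → colorCount c t ≡ g t) → Pushforward f g (colorCount (recolor f c))
recolor-pushforward {f = f} f-inj c counts = record
  { on-image  = λ t → trans (colorCount-cong (recolor f c) c (λ x y → ≟-injective (c x y) t)) (counts t)
  ; off-image = λ i missed → colorCount-unused (recolor f c) (λ x y → missed (c x y))
  }
  where
  ≟-injective : ∀ u t → ⌊ f u ≟ᶠ f t ⌋ ≡ ⌊ u ≟ᶠ t ⌋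
  ≟-injective u t with u ≟ᶠ t
  ... | yes refl = ⌊⌋-true (f u ≟ᶠ f u) refl
  ... | no u≢t = ⌊⌋-false (f u ≟ᶠ f t) (u≢t ∘ f-inj)

module _ (c₀ : Fin k) (cA : Coloring a k) (cB : Coloring b k) where

  glueBlocks : Fin a ⊎ Fin b → Fin a ⊎ Fin b → Fin k
  glueBlocks (inj₁ x) (inj₁ y) = cA x y
  glueBlocks (inj₂ x) (inj₂ y) = cB x y
  glueBlocks (inj₁ _) (inj₂ _) = c₀
  glueBlocks (inj₂ _) (inj₁ _) = c₀

  glue : Coloring (a + b) k
  glue u v = glueBlocks (splitAt a u) (splitAt a v)

  glue-symmetric : Symmetric cA → Symmetric cB → Symmetric glue
  glue-symmetric sym-A sym-B u v = blocks-symmetric (splitAt a u) (splitAt a v)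
    where
    blocks-symmetric : ∀ p q → glueBlocks p q ≡ glueBlocks q p
    blocks-symmetric (inj₁ x) (inj₁ y) = sym-A x y
    blocks-symmetric (inj₁ _) (inj₂ _) = refl
    blocks-symmetric (inj₂ _) (inj₁ _) = refl
    blocks-symmetric (inj₂ x) (inj₂ y) = sym-B x y

  glue-gallai : Gallai cA → Gallai cB → Gallai glue
  glue-gallai gallai-A gallai-B u v w u≢v v≢w u≢w =
    blocks-gallai (splitAt a u) (splitAt a v) (splitAt a w) (split-≢ u≢v) (split-≢ v≢w) (split-≢ u≢w)
    where
    split-≢ : ∀ {u v} → u ≢ v → splitAt a u ≢ splitAt a v
    split-≢ {u} {v} u≢v eq =
      u≢v (trans (sym (join-splitAt a b u)) (trans (cong (join a b) eq) (join-splitAt a b v)))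
    blocks-gallai : ∀ p q r → p ≢ q → q ≢ r → p ≢ r →
      ¬ (glueBlocks p q ≢ glueBlocks q r × glueBlocks q r ≢ glueBlocks p r × glueBlocks p q ≢ glueBlocks p r)
    blocks-gallai (inj₁ x) (inj₁ y) (inj₁ z) p≢q q≢r p≢r =
      gallai-A x y z (p≢q ∘ cong inj₁) (q≢r ∘ cong inj₁) (p≢r ∘ cong inj₁)
    blocks-gallai (inj₂ x) (inj₂ y) (inj₂ z) p≢q q≢r p≢r =
      gallai-B x y z (p≢q ∘ cong inj₂) (q≢r ∘ cong inj₂) (p≢r ∘ cong inj₂)
    blocks-gallai (inj₁ _) (inj₁ _) (inj₂ _) _ _ _ (_ , ≢ , _) = ≢ refl
    blocks-gallai (inj₁ _) (inj₂ _) (inj₁ _) _ _ _ (≢ , _ , _) = ≢ refl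
    blocks-gallai (inj₁ _) (inj₂ _) (inj₂ _) _ _ _ (_ , _ , ≢) = ≢ refl
    blocks-gallai (inj₂ _) (inj₁ _) (inj₁ _) _ _ _ (_ , _ , ≢) = ≢ refl
    blocks-gallai (inj₂ _) (inj₁ _) (inj₂ _) _ _ _ (≢ , _ , _) = ≢ refl
    blocks-gallai (inj₂ _) (inj₂ _) (inj₁ _) _ _ _ (_ , ≢ , _) = ≢ refl

  module _ (i : Fin k) where

    edge-↑ˡ-↑ˡ : ∀ x x′ → edgeOfColor glue i (x ↑ˡ b) (x′ ↑ˡ b) ≡ edgeOfColor cA i x x′
    edge-↑ˡ-↑ˡ x x′ rewrite toℕ-↑ˡ x b | toℕ-↑ˡ x′ b | splitAt-↑ˡ a x b | splitAt-↑ˡ a x′ b = refl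

    edge-↑ʳ-↑ʳ : ∀ y y′ → edgeOfColor glue i (a ↑ʳ y) (a ↑ʳ y′) ≡ edgeOfColor cB i y y′
    edge-↑ʳ-↑ʳ y y′ rewrite toℕ-↑ʳ a y | toℕ-↑ʳ a y′ | ⌊a+m<?a+n⌋≡⌊m<?n⌋ a (toℕ y) (toℕ y′)
                          | splitAt-↑ʳ a b y | splitAt-↑ʳ a b y′ = refl

    edge-↑ˡ-↑ʳ : ∀ x y → edgeOfColor glue i (x ↑ˡ b) (a ↑ʳ y) ≡ (if ⌊ c₀ ≟ᶠ i ⌋ then 1 else 0)
    edge-↑ˡ-↑ʳ x y rewrite toℕ-↑ˡ x b | toℕ-↑ʳ a y | splitAt-↑ˡ a x b | splitAt-↑ʳ a b y
                         | ⌊⌋-true (toℕ x <? a + toℕ y) (<-≤-trans (toℕ<n x) (m≤m+n a (toℕ y))) = refl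

    edge-↑ʳ-↑ˡ : ∀ y x → edgeOfColor glue i (a ↑ʳ y) (x ↑ˡ b) ≡ 0
    edge-↑ʳ-↑ˡ y x rewrite toℕ-↑ʳ a y | toℕ-↑ˡ x b
                         | ⌊⌋-false (a + toℕ y <? toℕ x) (<⇒≱ (toℕ<n x) ∘ ≤-trans (m≤m+n a (toℕ y)) ∘ <⇒≤) = refl

    colorCount-glue :
      colorCount glue i ≡ colorCount cA i + (if ⌊ c₀ ≟ᶠ i ⌋ then a * b else 0) + colorCount cB i
    colorCount-glue = begin
      colorCount glue i
        ≡⟨ colorCount-∑ glue i ⟩
      ∑[ u < a + b ] ∑[ v < a + b ] E u v
        ≡⟨ ∑-↑ a (λ u → ∑[ v < a + b ] E u v) ⟩
      ∑[ x < a ] ∑[ v < a + b ] E (x ↑ˡ b) v + ∑[ y < b ] ∑[ v < a + b ] E (a ↑ʳ y) v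
        ≡⟨ cong₂ _+_ (sum-cong-≗ (λ x → ∑-↑ a (E (x ↑ˡ b)))) (sum-cong-≗ (λ y → ∑-↑ a (E (a ↑ʳ y)))) ⟩
      ∑[ x < a ] (∑[ x′ < a ] E (x ↑ˡ b) (x′ ↑ˡ b) + ∑[ y < b ] E (x ↑ˡ b) (a ↑ʳ y)) +
      ∑[ y < b ] (∑[ x < a ] E (a ↑ʳ y) (x ↑ˡ b) + ∑[ y′ < b ] E (a ↑ʳ y) (a ↑ʳ y′))
        ≡⟨ cong₂ _+_ (∑-distrib-+ {a} _ _) (∑-distrib-+ {b} _ _) ⟩
      (∑[ x < a ] ∑[ x′ < a ] E (x ↑ˡ b) (x′ ↑ˡ b) + ∑[ x < a ] ∑[ y < b ] E (x ↑ˡ b) (a ↑ʳ y)) +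
      (∑[ y < b ] ∑[ x < a ] E (a ↑ʳ y) (x ↑ˡ b) + ∑[ y < b ] ∑[ y′ < b ] E (a ↑ʳ y) (a ↑ʳ y′))
        ≡⟨ cong₂ _+_ (cong₂ _+_ (trans (∑∑-cong edge-↑ˡ-↑ˡ) (sym (colorCount-∑ cA i)))
                                (trans (∑∑-cong edge-↑ˡ-↑ʳ) (∑∑-indicator a b ⌊ c₀ ≟ᶠ i ⌋)))
                     (cong₂ _+_ (trans (∑∑-cong edge-↑ʳ-↑ˡ) (∑∑-indicator b a false))
                                (trans (∑∑-cong edge-↑ʳ-↑ʳ) (sym (colorCount-∑ cB i)))) ⟩
      (colorCount cA i + (if ⌊ c₀ ≟ᶠ i ⌋ then a * b else 0)) + (0 + colorCount cB i)
        ∎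
      where
      open ≡-Reasoning
      E = edgeOfColor glue i

-- The colors after the first are grouped in pairs: paired s b is color 1 + 2s + b.
paired : Fin j → Fin 2 → Fin (suc (j * 2))
paired s b = suc (combine s b)

paired-injective : ∀ {s s′ : Fin j} {b b′} → paired s b ≡ paired s′ b′ → s ≡ s′ × b ≡ b′
paired-injective {s = s} {s′} {b} {b′} eq =
  combine-injectiveˡ s b s′ b′ (fsuc-injective eq) , combine-injectiveʳ s b s′ b′ (fsuc-injective eq)

paired-0<1 : (s : Fin j) → paired s 0F ≤ᶠ paired s 1F
paired-0<1 s = s≤s (begin
  toℕ (combine s 0F) ≡⟨ toℕ-combine s 0F ⟩
  2 * toℕ s + 0      ≤⟨ +-monoʳ-≤ (2 * toℕ s) z≤n ⟩
  2 * toℕ s + 1      ≡⟨ toℕ-combine s 1F ⟨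
  toℕ (combine s 1F) ∎)
  where open ≤-Reasoning

paired-mono : ∀ {s s′ : Fin j} b b′ → s <ᶠ s′ → paired s b ≤ᶠ paired s′ b′
paired-mono b b′ s<s′ = s≤s (<⇒≤ (combine-monoˡ-< b b′ s<s′))

colorB : Fin (suc j) → Fin (suc (j * 2))
colorB zero = zero
colorB (suc s) = paired s 0F

colorA : Fin (suc j) → Fin (suc j) → Fin (suc (j * 2))
colorA t₀ zero = colorB t₀
colorA t₀ (suc s) = paired s 1F

colorB≢paired1 : (t : Fin (suc j)) (s : Fin j) → colorB t ≢ paired s 1F
colorB≢paired1 zero s ()
colorB≢paired1 {j} (suc t) s eq with () ← proj₂ (paired-injective {j} eq)

colorB-injective : Injective _≡_ _≡_ (colorB {j})
colorB-injective {x = zero} {y = zero} eq = refl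
colorB-injective {x = suc t} {y = suc t′} eq = cong suc (proj₁ (paired-injective eq))

colorA-injective : (t₀ : Fin (suc j)) → Injective _≡_ _≡_ (colorA t₀)
colorA-injective t₀ {zero} {zero} eq = refl
colorA-injective t₀ {zero} {suc s} eq = contradiction eq (colorB≢paired1 t₀ s)
colorA-injective t₀ {suc s} {zero} eq = contradiction (sym eq) (colorB≢paired1 t₀ s)
colorA-injective t₀ {suc s} {suc s′} eq = cong suc (proj₁ (paired-injective eq))

color-cases : (i : Fin (suc (j * 2))) → (∃ λ t → colorB {j} t ≡ i) ⊎ (∃ λ s → paired {j} s 1F ≡ i)
color-cases zero = inj₁ (zero , refl)
color-cases {j} (suc i) with combine-surjective {j} {2} i
... | s , 0F , refl = inj₁ (suc s , refl)
... | s , 1F , refl = inj₂ (s , refl)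

module Split {j₂ : ℕ} (m : ℕ) (e : Fin (suc (suc j₂ * 2)) → ℕ) (e-noninc : Nonincreasing e)
             (m²≤e₀ : m * m ≤ e zero) (∑e : ∑[ i < suc (suc j₂ * 2) ] e i ≡ m * m + (m C 2 + m C 2)) where

  larger smaller : Fin (suc j₂) → ℕ
  larger s = e (paired s 0F)
  smaller s = e (paired s 1F)

  L W r : ℕ
  L = ∑[ s < suc j₂ ] larger s
  W = ∑[ s < suc j₂ ] smaller s
  r = e zero ∸ m * m

  r+L+W≡mC2+mC2 : r + L + W ≡ m C 2 + m C 2
  r+L+W≡mC2+mC2 = +-cancelˡ-≡ (m * m) _ _ (begin
    m * m + (r + L + W)    ≡⟨ cong (m * m +_) (+-assoc r L W) ⟩
    m * m + (r + (L + W))  ≡⟨ +-assoc (m * m) r (L + W) ⟨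
    m * m + r + (L + W)    ≡⟨ cong (_+ (L + W)) (m+[n∸m]≡n m²≤e₀) ⟩
    e zero + (L + W)       ≡⟨ cong (e zero +_) ∑e∘suc ⟨
    ∑[ i < _ ] e i         ≡⟨ ∑e ⟩
    m * m + (m C 2 + m C 2) ∎)
    where
    open ≡-Reasoning
    ∑e∘suc : ∑[ i < suc j₂ * 2 ] e (suc i) ≡ L + W
    ∑e∘suc = begin
      ∑[ i < suc j₂ * 2 ] e (suc i)                ≡⟨ ∑-combine (suc j₂) (e ∘ suc) ⟩
      ∑[ s < suc j₂ ] (larger s + (smaller s + 0)) ≡⟨ sum-cong-≗ {suc j₂} (λ s → cong (larger s +_) (+-identityʳ (smaller s))) ⟩
      ∑[ s < suc j₂ ] (larger s + smaller s)       ≡⟨ ∑-distrib-+ larger smaller ⟩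
      L + W                                        ∎

  W≤mC2 : W ≤ m C 2
  W≤mC2 = ≮⇒≥ λ mC2<W → <⇒≱ (+-mono-< mC2<W mC2<W) (begin
    W + W          ≤⟨ +-monoˡ-≤ W (∑-mono-≤ {suc j₂} (λ s → e-noninc _ _ (paired-0<1 s))) ⟩
    L + W          ≤⟨ m≤n+m (L + W) r ⟩
    r + (L + W)    ≡⟨ +-assoc r L W ⟨
    r + L + W      ≡⟨ r+L+W≡mC2+mC2 ⟩
    m C 2 + m C 2  ∎)
    where open ≤-Reasoning

  d : ℕ
  d = m C 2 ∸ W

  d+W≡mC2 : d + W ≡ m C 2
  d+W≡mC2 = m∸n+n≡m W≤mC2

  baseB : Fin (suc (suc j₂)) → ℕ
  baseB zero = r
  baseB (suc s) = larger s

  -- Block A takes the smaller color of each pair and d edges of B's color colorB t₀.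
  seqA : Fin (suc (suc j₂)) → ℕ
  seqA zero = d
  seqA (suc s) = smaller s

  seqB : Fin (suc (suc j₂)) → Fin (suc (suc j₂)) → ℕ
  seqB t₀ = updateAt baseB t₀ (_∸ d)

  ∑seqA : ∑[ t < suc (suc j₂) ] seqA t ≡ m C 2
  ∑seqA = d+W≡mC2

  ∑seqB : (t₀ : Fin (suc (suc j₂))) → d ≤ baseB t₀ → ∑[ t < suc (suc j₂) ] seqB t₀ t ≡ m C 2
  ∑seqB t₀ d≤ = +-cancelʳ-≡ (d + W) _ _ (begin
    ∑[ t < _ ] seqB t₀ t + (d + W)  ≡⟨ +-assoc (∑[ t < suc (suc j₂) ] seqB t₀ t) d W ⟨
    ∑[ t < _ ] seqB t₀ t + d + W    ≡⟨ cong (_+ W) (∑-updateAt-∸ baseB t₀ d≤) ⟩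
    r + L + W                       ≡⟨ r+L+W≡mC2+mC2 ⟩
    m C 2 + m C 2                   ≡⟨ cong (m C 2 +_) d+W≡mC2 ⟨
    m C 2 + (d + W)                 ∎)
    where open ≡-Reasoning

  -- If d > e₁, then B's colors other than its first weigh at most e₁ + W < m C 2, as each
  -- larger (suc s) ≤ smaller s; so the first color of B has at least d edges.
  transfer-slot : ∃ λ t₀ → d ≤ baseB t₀
  transfer-slot with d ≤? larger 0F
  ... | yes d≤e₁ = 1F , d≤e₁
  ... | no d≰e₁ = 0F , +-cancelʳ-≤ W d r (+-cancelʳ-≤ (m C 2) (d + W) (r + W) (begin
    d + W + m C 2      ≡⟨ cong (_+ m C 2) d+W≡mC2 ⟩
    m C 2 + m C 2      ≡⟨ r+L+W≡mC2+mC2 ⟨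
    r + (e₁ + L′) + W  ≤⟨ +-monoˡ-≤ W (+-monoʳ-≤ r (+-monoʳ-≤ e₁ L′≤W)) ⟩
    r + (e₁ + W) + W   ≡⟨ rearrange r e₁ W ⟩
    r + W + (e₁ + W)   ≤⟨ +-monoʳ-≤ (r + W) e₁+W≤mC2 ⟩
    r + W + m C 2      ∎))
    where
    open ≤-Reasoning
    e₁ = larger 0F
    L′ = ∑[ s < j₂ ] larger (suc s)
    L′≤W : L′ ≤ W
    L′≤W = begin
      L′                                                   ≤⟨ ∑-mono-≤ {j₂} (λ s → e-noninc _ _
                                                                (paired-mono {suc j₂} 1F 0F (s≤s (≤-reflexive (toℕ-inject₁ s))))) ⟩
      ∑[ s < j₂ ] smaller (inject₁ s)                      ≤⟨ m≤m+n _ _ ⟩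
      ∑[ s < j₂ ] smaller (inject₁ s) + smaller (fromℕ j₂) ≡⟨ sum-init-last smaller ⟨
      W                                                    ∎
    e₁+W≤mC2 : e₁ + W ≤ m C 2
    e₁+W≤mC2 = ≤-trans (+-monoˡ-≤ W (<⇒≤ (≰⇒> d≰e₁))) (≤-reflexive d+W≡mC2)
    rearrange : ∀ r e w → r + (e + w) + w ≡ r + w + (e + w)
    rearrange = solve-∀

  count-decomposition : (t₀ : Fin (suc (suc j₂))) → d ≤ baseB t₀ → {κA κB : Fin (suc (suc j₂ * 2)) → ℕ} →
    Pushforward (colorA t₀) seqA κA → Pushforward colorB (seqB t₀) κB →
    ∀ i → κA i + (if ⌊ zero ≟ᶠ i ⌋ then m * m else 0) + κB i ≡ e i
  count-decomposition t₀ d≤ {κA} {κB} pushA pushB i with color-cases {suc j₂} i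
  ... | inj₂ (s , refl) = begin
    κA (paired s 1F) + 0 + κB (paired s 1F) ≡⟨ cong₂ (λ p q → p + 0 + q) (on-image pushA (suc s))
                                                  (off-image pushB _ (λ t → colorB≢paired1 t s)) ⟩
    smaller s + 0 + 0                       ≡⟨ trans (+-identityʳ _) (+-identityʳ _) ⟩
    smaller s                               ∎
    where
    open ≡-Reasoning
    open Pushforward
  ... | inj₁ (t , refl) = begin
    κA (colorB t) + X + κB (colorB t)  ≡⟨ cong (κA (colorB t) + X +_) (on-image pushB t) ⟩
    κA (colorB t) + X + seqB t₀ t      ≡⟨ cong (_+ seqB t₀ t) (+-comm (κA (colorB t)) X) ⟩
    X + κA (colorB t) + seqB t₀ t      ≡⟨ +-assoc X _ _ ⟩
    X + (κA (colorB t) + seqB t₀ t)    ≡⟨ cong (X +_) transfer ⟩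
    X + baseB t                        ≡⟨ cross+baseB t ⟩
    e (colorB t)                       ∎
    where
    open ≡-Reasoning
    open Pushforward
    X = if ⌊ zero ≟ᶠ colorB t ⌋ then m * m else 0
    transfer : κA (colorB t) + seqB t₀ t ≡ baseB t
    transfer with t ≟ᶠ t₀
    ... | yes refl = trans (cong₂ _+_ (on-image pushA zero) (updateAt-updates t₀ baseB)) (m+[n∸m]≡n d≤)
    ... | no t≢t₀ = cong₂ _+_ (off-image pushA _ missed) (updateAt-minimal t t₀ baseB t≢t₀)
      where
      missed : ∀ u → colorA t₀ u ≢ colorB t
      missed zero eq = t≢t₀ (sym (colorB-injective eq))
      missed (suc s) eq = colorB≢paired1 t s (sym eq)
    cross+baseB : ∀ t → (if ⌊ zero ≟ᶠ colorB t ⌋ then m * m else 0) + baseB t ≡ e (colorB t)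
    cross+baseB zero = m+[n∸m]≡n m²≤e₀
    cross+baseB (suc s) = refl

  IsGSeq-m+m : AllGSeq m (suc (suc j₂)) → IsGSeq (m + m) (suc (suc j₂ * 2)) e
  IsGSeq-m+m all-m with transfer-slot
  ... | t₀ , d≤ with all-m seqA (trans (sum-map-allFin seqA) ∑seqA)
                   | all-m (seqB t₀) (trans (sum-map-allFin (seqB t₀)) (∑seqB t₀ d≤))
  ... | cA , sym-A , gallai-A , counts-A | cB , sym-B , gallai-B , counts-B =
    glue zero cA′ cB′ ,
    glue-symmetric zero cA′ cB′ (recolor-symmetric (colorA t₀) sym-A) (recolor-symmetric colorB sym-B) ,
    glue-gallai zero cA′ cB′ (recolor-gallai (colorA t₀) gallai-A) (recolor-gallai colorB gallai-B) ,
    λ i → trans (colorCount-glue zero cA′ cB′ i)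
                (count-decomposition t₀ d≤ (recolor-pushforward (colorA-injective t₀) cA counts-A)
                                           (recolor-pushforward colorB-injective cB counts-B) i)
    where
    cA′ cB′ : Coloring m (suc (suc j₂ * 2))
    cA′ = recolor (colorA t₀) cA
    cB′ = recolor colorB cB

heavy-first-color⇒IsGSeq : ∀ {j₂} m → AllGSeq m (suc (suc j₂)) → (e : Fin (suc (suc j₂ * 2)) → ℕ) →
  IsSeq (2 * m) (suc (suc j₂ * 2)) e → Nonincreasing e → m * m ≤ e zero →
  IsGSeq (2 * m) (suc (suc j₂ * 2)) e
heavy-first-color⇒IsGSeq {j₂} m all-m e seq e-noninc m²≤e₀ =
  subst (λ n → IsGSeq n _ e) (cong (m +_) (sym (+-identityʳ m))) (IsGSeq-m+m all-m)
  where
  ∑e : ∑[ i < suc (suc j₂ * 2) ] e i ≡ m * m + (m C 2 + m C 2)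
  ∑e = begin
    ∑[ i < _ ] e i                          ≡⟨ sum-map-allFin e ⟨
    List.sum (map e (allFin _))             ≡⟨ seq ⟩
    (m + (m + 0)) C 2                       ≡⟨ cong (λ x → (m + x) C 2) (+-identityʳ m) ⟩
    (m + m) C 2                             ≡⟨ [m+n]C2≡mC2+m*n+nC2 m m ⟩
    m C 2 + m * m + m C 2                   ≡⟨ cong (_+ m C 2) (+-comm (m C 2) (m * m)) ⟩
    m * m + m C 2 + m C 2                   ≡⟨ +-assoc (m * m) _ _ ⟩
    m * m + (m C 2 + m C 2)                 ∎
    where open ≡-Reasoning
  open Split {j₂} m e e-noninc m²≤e₀ ∑e

2*[1+n]∸1≡1+n*2 : ∀ n → 2 * suc n ∸ 1 ≡ suc (n * 2)
2*[1+n]∸1≡1+n*2 n = trans (+-suc n (n + 0)) (cong suc (*-comm 2 n))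

lemma4p2 : (j m : ℕ) → 2 ≤ j → IsG j m →
    (e : Fin (2 * j ∸ 1) → ℕ) → IsSeq (2 * m) (2 * j ∸ 1) e → Nonincreasing e →
    ((i : Fin (2 * j ∸ 1)) → toℕ i ≡ 0 → m * m ≤ e i) →
    IsGSeq (2 * m) (2 * j ∸ 1) e
lemma4p2 (suc (suc j₂)) m (s≤s (s≤s z≤n)) (_ , all-from-m , _) =
  subst (λ k → (e : Fin k → ℕ) → IsSeq (2 * m) k e → Nonincreasing e →
               ((i : Fin k) → toℕ i ≡ 0 → m * m ≤ e i) → IsGSeq (2 * m) k e)
        (sym (2*[1+n]∸1≡1+n*2 (suc j₂)))
        (λ e seq e-noninc top → heavy-first-color⇒IsGSeq m (all-from-m m ≤-refl) e seq e-noninc (top zero refl))
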